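{- Let $\rho\in\{\rho^+,\rho^-\}$ be an atomic rule and $\mu\in\{\pi^+,\pi^-,\mathfrak{4},\lambda,\mathsf{J}\}$. For all modal trees $\mathtt{T},\mathtt{S}$: if $\mathtt{T}\hookrightarrow^{\rho}\circ\hookrightarrow^{\mu}\mathtt{S}$, then $\mathtt{T}\hookrightarrow^{\mu}\circ\hookrightarrow^{\rho*}\mathtt{S}$.
   Context: Modal trees: recursively, pairs $\langle\Delta;\Gamma\rangle$ with $\Delta$ a finite list of propositional variables and $\Gamma$ a finite list of pairs $(\alpha,\mathtt{S})$, $\alpha<\omega$, $\mathtt{S}$ a modal tree. Positions: $\mathrm{Pos}(\langle\Delta;\varnothing\rangle)=\{\epsilon\}$; $\mathrm{Pos}(\langle\Delta;[(\alpha_1,\mathtt{S}_1),\dots,(\alpha_n,\mathtt{S}_n)]\rangle)=\{\epsilon\}\cup\bigcup_{i=1}^n\{i\mathbf{k}\mid\mathbf{k}\in\mathrm{Pos}(\mathtt{S}_i)\}$. Subtree: $\mathtt{T}|_\epsilon=\mathtt{T}$, $\mathtt{T}|_{i\mathbf{r}}=\mathtt{S}_i|_{\mathbf{r}}$. Replacement: $\mathtt{T}[\mathtt{S}]_\epsilon=\mathtt{S}$, $\mathtt{T}[\mathtt{S}]_{i\mathbf{r}}$ is $\mathtt{T}$ with its $i$-th child $\mathtt{S}_i$ replaced by $\mathtt{S}_i[\mathtt{S}]_{\mathbf{r}}$ (same edge label). List operations, for $0<i,j\le|\Gamma|$: $\#_i\Gamma$ is the $i$-th element; $\Gamma^{ -i}$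 deletes it; $\Gamma^{+i}=(\#_i\Gamma)\frown\Gamma$; $\Gamma[x]_i$ replaces the $i$-th element by $x$; similarly $\Delta^{ -n}$ deletes the $n$-th element of $\Delta$ and $\Delta^{+n}=(n\text{ -th element of }\Delta)\frown\Delta$. Rules: for a modal tree $\mathtt{T}$, $\mathbf{k}\in\mathrm{Pos}(\mathtt{T})$ with $\mathtt{T}|_\mathbf{k}=\langle\Delta;\Gamma\rangle$: ($\rho^+$) $\mathtt{T}\hookrightarrow^{\rho^+}\mathtt{T}[\langle\Delta^{+i};\Gamma\rangle]_\mathbf{k}$, $0<i\le|\Delta|$; ($\rho^-$) $\mathtt{T}\hookrightarrow^{\rho^- }\mathtt{T}[\langle\Delta^{ -i};\Gamma\rangle]_\mathbf{k}$; ($\pi^+$) $\mathtt{T}\hookrightarrow^{\pi^+}\mathtt{T}[\langle\Delta;\Gamma^{+i}\rangle]_\mathbf{k}$; ($\pi^-$) $\mathtt{T}\hookrightarrow^{\pi^- }\mathtt{T}[\langle\Delta;\Gamma^{ -i}\rangle]_\mathbf{k}$; ($\mathfrak{4}$) if $\#_i\Gamma=(\beta,\langle\tilde\Delta;\tilde\Gamma\rangle)$ and $\#_j\tilde\Gamma=(\beta,\mathtt{S})$, then $\mathtt{T}\hookrightarrow^{\mathfrak{4}}\mathtt{T}[\langle\Delta;\Gamma[(\beta,\mathtt{S})]_i\rangle]_\mathbf{k}$; ($\lambda$) if $\#_i\Gamma=(\alpha,\mathtt{S})$ and $\alpha>\beta$, then $\mathtt{T}\hookrightarrow^{\lambda}\mathtt{T}[\langle\Delta;\Gamma[(\beta,\mathtt{S})]_i\rangle]_\mathbf{k}$;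 ($\mathsf{J}$) if $i\ne j$, $\#_i\Gamma=(\alpha,\langle\tilde\Delta;\tilde\Gamma\rangle)$, $\#_j\Gamma=(\beta,\mathtt{S})$, $\alpha>\beta$, then $\mathtt{T}\hookrightarrow^{\mathsf{J}}\mathtt{T}[\langle\Delta;(\Gamma[(\alpha,\langle\tilde\Delta;\tilde\Gamma\frown(\beta,\mathtt{S})\rangle)]_i)^{ -j}\rangle]_\mathbf{k}$. Notation: $\mathtt{T}\hookrightarrow^{\mu_1}\circ\hookrightarrow^{\mu_2}\mathtt{S}$ means there is $\mathtt{U}$ with $\mathtt{T}\hookrightarrow^{\mu_1}\mathtt{U}\hookrightarrow^{\mu_2}\mathtt{S}$; $\hookrightarrow^{\rho*}$ means zero or more applications of rule $\rho$. -}

module Defs where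

open import Data.Nat using (ℕ; _<_)
open import Data.Fin using (Fin; cast)
open import Data.Product using (_×_; _,_)
open import Data.List using (List; []; _∷_; length; lookup; removeAt; _[_]∷=_; _++_; [_])
open import Data.List.Properties using (length-∷=)
open import Relation.Binary.PropositionalEquality using (_≡_; _≢_; sym)
open import Relation.Binary.Construct.Closure.ReflexiveTransitive using (Star)

-- Propositional variables are indexed by ℕ; edge labels α < ω are natural numbers.
PropVar : Set
PropVar = ℕ

data Tree : Set where
  node : List PropVar → List (ℕ × Tree) → Tree

data AtomicRule : Set where
  ρ⁺ ρ⁻ : AtomicRule

data OtherRule : Set where
  π⁺ π⁻ r4 rλ rJ : OtherRule

data Rule : Set where
  atomic : AtomicRule → Rule
  other  : OtherRule → Rule

-- One application of a rule at the root position ε.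
-- Indices are Fin (length …) (0-based internally; the paper's 1-based i corresponds to Fin index i-1).
data RootStep : Rule → Tree → Tree → Set where
  step-ρ⁺ : ∀ {Δ Γ} (i : Fin (length Δ)) →
            RootStep (atomic ρ⁺) (node Δ Γ) (node (lookup Δ i ∷ Δ) Γ)
  step-ρ⁻ : ∀ {Δ Γ} (i : Fin (length Δ)) →
            RootStep (atomic ρ⁻) (node Δ Γ) (node (removeAt Δ i) Γ)
  step-π⁺ : ∀ {Δ Γ} (i : Fin (length Γ)) →
            RootStep (other π⁺) (node Δ Γ) (node Δ (lookup Γ i ∷ Γ))
  step-π⁻ : ∀ {Δ Γ} (i : Fin (length Γ)) →
            RootStep (other π⁻) (node Δ Γ) (node Δ (removeAt Γ i))
  step-4  : ∀ {Δ Γ β Δ' Γ' S} (i : Fin (length Γ)) →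
            lookup Γ i ≡ (β , node Δ' Γ') →
            (j : Fin (length Γ')) → lookup Γ' j ≡ (β , S) →
            RootStep (other r4) (node Δ Γ) (node Δ (Γ [ i ]∷= (β , S)))
  step-λ  : ∀ {Δ Γ α β S} (i : Fin (length Γ)) →
            lookup Γ i ≡ (α , S) → β < α →
            RootStep (other rλ) (node Δ Γ) (node Δ (Γ [ i ]∷= (β , S)))
  step-J  : ∀ {Δ Γ α β Δ' Γ' S} (i j : Fin (length Γ)) → i ≢ j →
            lookup Γ i ≡ (α , node Δ' Γ') → lookup Γ j ≡ (β , S) → β < α →
            RootStep (other rJ) (node Δ Γ)
              (node Δ (removeAt (Γ [ i ]∷= (α , node Δ' (Γ' ++ [ (β , S) ])))
                                (cast (sym (length-∷= Γ i (α , node Δ' (Γ' ++ [ (β , S) ])))) j)))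

-- T ↪^r S : application of rule r at some position k of T, i.e.
-- T ↪ T[U']_k where T|_k = U and U ↪ U' at the root.
-- (Inductive rendering of positions/subtree/replacement: position ε, or i·k in the i-th child.)
data Step (r : Rule) : Tree → Tree → Set where
  here  : ∀ {T S} → RootStep r T S → Step r T S
  under : ∀ {Δ Γ α U U'} (i : Fin (length Γ)) → lookup Γ i ≡ (α , U) →
          Step r U U' → Step r (node Δ Γ) (node Δ (Γ [ i ]∷= (α , U')))

_then_ : (Tree → Tree → Set) → (Tree → Tree → Set) → Tree → Tree → Set
(R₁ then R₂) T S = Data.Product.Σ Tree (λ U → R₁ T U × R₂ U S)

Steps* : Rule → Tree → Tree → Set
Steps* r = Star (Step r)

{-# OPTIONS --safe #-}
module Submission where

-- A ρ-step only edits the variable list of a single node; it changes neither the shape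
-- of the tree nor any edge label. We therefore generalise it to parallel ρ-reduction
-- T ⇛ U: T and U have the same shape and labels, and at every node the variable list of
-- U is reached from that of T by ρ-steps. A single ρ-step is a ⇛-step and a ⇛-step is a
-- finite sequence of ρ-steps. The point is that ⇛ can be postponed past any structural
-- step: if T ⇛ U ↪^μ S, then the same μ-step, at the same position and indices, applies
-- to T, and its result is again ⇛-related to S (π⁺ duplicates the ⇛-relation of the
-- copied subtree, π⁻ forgets one, and 4, λ and J only move related subtrees around).

open import Defs
open import Level using (Level)
open import Function using (_∘_)
open import Data.Nat using (ℕ)
open import Data.Nat.Properties using (suc-injective)
open import Data.Fin using (Fin; toℕ; cast; zero; suc)
open import Data.Fin.Properties using (toℕ-cast; toℕ-injective)
open import Data.Product using (∃; _×_; _,_; map₁; map₂)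
open import Data.List using (List; []; _∷_; length; lookup; removeAt; _[_]∷=_)
open import Data.List.Relation.Binary.Pointwise
  using (Pointwise; []; _∷_; Pointwise-length; ++⁺) renaming (refl to Pointwise-refl)
open import Relation.Binary.Core using (REL)
open import Relation.Binary.Definitions using (Reflexive)
open import Relation.Binary.PropositionalEquality using (_≡_; refl; sym; trans; cong)
open import Relation.Binary.Construct.Closure.ReflexiveTransitive using (Star; ε; _◅_; _◅◅_; gmap)

module _ {a b ℓ : Level} {A : Set a} {B : Set b} {R : REL A B ℓ} where

  lookup-toℕ⁺ : ∀ {xs ys} → Pointwise R xs ys →
                (i : Fin (length xs)) (j : Fin (length ys)) → toℕ i ≡ toℕ j →
                R (lookup xs i) (lookup ys j)
  lookup-toℕ⁺ (r ∷ rs) zero    zero    _    = r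
  lookup-toℕ⁺ (r ∷ rs) (suc i) (suc j) i≡j = lookup-toℕ⁺ rs i j (suc-injective i≡j)

  ∷=-toℕ⁺ : ∀ {xs ys x y} → Pointwise R xs ys →
            (i : Fin (length xs)) (j : Fin (length ys)) → toℕ i ≡ toℕ j →
            R x y → Pointwise R (xs [ i ]∷= x) (ys [ j ]∷= y)
  ∷=-toℕ⁺ (r ∷ rs) zero    zero    _    rxy = rxy ∷ rs
  ∷=-toℕ⁺ (r ∷ rs) (suc i) (suc j) i≡j rxy = r ∷ ∷=-toℕ⁺ rs i j (suc-injective i≡j) rxy

  removeAt-toℕ⁺ : ∀ {xs ys} → Pointwise R xs ys →
                  (i : Fin (length xs)) (j : Fin (length ys)) → toℕ i ≡ toℕ j →
                  Pointwise R (removeAt xs i) (removeAt ys j)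
  removeAt-toℕ⁺ (r ∷ rs) zero    zero    _    = rs
  removeAt-toℕ⁺ (r ∷ rs) (suc i) (suc j) i≡j = r ∷ removeAt-toℕ⁺ rs i j (suc-injective i≡j)

  backIndex : ∀ {xs ys} → Pointwise R xs ys → Fin (length ys) → Fin (length xs)
  backIndex rs = cast (sym (Pointwise-length rs))

  toℕ-backIndex : ∀ {xs ys} (rs : Pointwise R xs ys) (j : Fin (length ys)) →
                  toℕ (backIndex rs j) ≡ toℕ j
  toℕ-backIndex rs = toℕ-cast _

  backIndex-injective : ∀ {xs ys} (rs : Pointwise R xs ys) {i j : Fin (length ys)} →
                        backIndex rs i ≡ backIndex rs j → i ≡ j
  backIndex-injective rs {i} {j} i′≡j′ =
    toℕ-injective (trans (sym (toℕ-backIndex rs i)) (trans (cong toℕ i′≡j′) (toℕ-backIndex rs j)))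

module _ {a ℓ : Level} {A : Set a} {R : REL A A ℓ} where

  ∷=-refl⁺ : Reflexive R → ∀ xs (i : Fin (length xs)) {x y} →
             lookup xs i ≡ x → R x y → Pointwise R xs (xs [ i ]∷= y)
  ∷=-refl⁺ rfl (_ ∷ xs) zero    refl rxy = rxy ∷ Pointwise-refl rfl
  ∷=-refl⁺ rfl (_ ∷ xs) (suc i) xs[i]≡x rxy = rfl ∷ ∷=-refl⁺ rfl xs i xs[i]≡x rxy

data VarStep : AtomicRule → List PropVar → List PropVar → Set where
  dup  : ∀ {Δ} (i : Fin (length Δ)) → VarStep ρ⁺ Δ (lookup Δ i ∷ Δ)
  drop : ∀ {Δ} (i : Fin (length Δ)) → VarStep ρ⁻ Δ (removeAt Δ i)

mutual
  data _⇛⟨_⟩_ : Tree → AtomicRule → Tree → Set where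
    node : ∀ {ρ Δ Δ′ Γ Γ′} → Star (VarStep ρ) Δ Δ′ → Pointwise (_⇛ᴱ⟨ ρ ⟩_) Γ Γ′ →
           node Δ Γ ⇛⟨ ρ ⟩ node Δ′ Γ′

  data _⇛ᴱ⟨_⟩_ : ℕ × Tree → AtomicRule → ℕ × Tree → Set where
    edge : ∀ {ρ α U U′} → U ⇛⟨ ρ ⟩ U′ → (α , U) ⇛ᴱ⟨ ρ ⟩ (α , U′)

module _ {ρ : AtomicRule} where

  mutual
    ⇛-refl : ∀ T → T ⇛⟨ ρ ⟩ T
    ⇛-refl (node Δ Γ) = node ε (⇛ᴱ-refl* Γ)

    ⇛ᴱ-refl* : ∀ Γ → Pointwise (_⇛ᴱ⟨ ρ ⟩_) Γ Γ
    ⇛ᴱ-refl* []            = []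
    ⇛ᴱ-refl* ((α , U) ∷ Γ) = edge (⇛-refl U) ∷ ⇛ᴱ-refl* Γ

  ⇛ᴱ-refl : Reflexive (_⇛ᴱ⟨ ρ ⟩_)
  ⇛ᴱ-refl {α , U} = edge (⇛-refl U)

  step⇒⇛ : ∀ {T U} → Step (atomic ρ) T U → T ⇛⟨ ρ ⟩ U
  step⇒⇛ (here (step-ρ⁺ i))          = node (dup i ◅ ε) (⇛ᴱ-refl* _)
  step⇒⇛ (here (step-ρ⁻ i))          = node (drop i ◅ ε) (⇛ᴱ-refl* _)
  step⇒⇛ (under {Γ = Γ} i Γ[i]≡αU s) = node ε (∷=-refl⁺ ⇛ᴱ-refl Γ i Γ[i]≡αU (edge (step⇒⇛ s)))

  varSteps⇒steps : ∀ {Δ Δ′ Γ} → Star (VarStep ρ) Δ Δ′ → Steps* (atomic ρ) (node Δ Γ) (node Δ′ Γ)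
  varSteps⇒steps = gmap (λ Δ → node Δ _) λ where
    (dup i)  → here (step-ρ⁺ i)
    (drop i) → here (step-ρ⁻ i)

  steps-under-head : ∀ {Δ α Γ U U′} → Steps* (atomic ρ) U U′ →
                     Steps* (atomic ρ) (node Δ ((α , U) ∷ Γ)) (node Δ ((α , U′) ∷ Γ))
  steps-under-head = gmap (λ U → node _ ((_ , U) ∷ _)) (under zero refl)

  steps-under-tail : ∀ {Δ Δ′ x Γ Γ′} → Steps* (atomic ρ) (node Δ Γ) (node Δ′ Γ′) →
                     Steps* (atomic ρ) (node Δ (x ∷ Γ)) (node Δ′ (x ∷ Γ′))
  steps-under-tail = gmap (consChild _) shift
    where
    consChild : ℕ × Tree → Tree → Tree
    consChild x (node Δ Γ) = node Δ (x ∷ Γ)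

    shift : ∀ {x T U} → Step (atomic ρ) T U → Step (atomic ρ) (consChild x T) (consChild x U)
    shift (here (step-ρ⁺ i))  = here (step-ρ⁺ i)
    shift (here (step-ρ⁻ i))  = here (step-ρ⁻ i)
    shift (under i Γ[i]≡αU s) = under (suc i) Γ[i]≡αU s

  mutual
    ⇛⇒steps : ∀ {T U} → T ⇛⟨ ρ ⟩ U → Steps* (atomic ρ) T U
    ⇛⇒steps (node Δ⇛Δ′ Γ⇛Γ′) = varSteps⇒steps Δ⇛Δ′ ◅◅ ⇛ᴱ*⇒steps Γ⇛Γ′

    ⇛ᴱ*⇒steps : ∀ {Δ Γ Γ′} → Pointwise (_⇛ᴱ⟨ ρ ⟩_) Γ Γ′ → Steps* (atomic ρ) (node Δ Γ) (node Δ Γ′)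
    ⇛ᴱ*⇒steps []               = ε
    ⇛ᴱ*⇒steps (edge U⇛U′ ∷ Γ⇛Γ′) = steps-under-head (⇛⇒steps U⇛U′) ◅◅ steps-under-tail (⇛ᴱ*⇒steps Γ⇛Γ′)

  ⇛ᴱ-inverse : ∀ {x α U} → x ⇛ᴱ⟨ ρ ⟩ (α , U) → ∃ λ T → x ≡ (α , T) × T ⇛⟨ ρ ⟩ U
  ⇛ᴱ-inverse (edge T⇛U) = _ , refl , T⇛U

  lookup-⇛ᴱ⁻ : ∀ {Γ Γ′ α U} (Γ⇛Γ′ : Pointwise (_⇛ᴱ⟨ ρ ⟩_) Γ Γ′) (j : Fin (length Γ′)) →
               lookup Γ′ j ≡ (α , U) →
               ∃ λ T → lookup Γ (backIndex Γ⇛Γ′ j) ≡ (α , T) × T ⇛⟨ ρ ⟩ U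
  lookup-⇛ᴱ⁻ Γ⇛Γ′ j refl = ⇛ᴱ-inverse (lookup-toℕ⁺ Γ⇛Γ′ _ j (toℕ-backIndex Γ⇛Γ′ j))

  ⇛-postpone-root : ∀ {μ T U S} → T ⇛⟨ ρ ⟩ U → RootStep (other μ) U S →
                    (RootStep (other μ) then _⇛⟨ ρ ⟩_) T S
  ⇛-postpone-root (node Δ⇛Δ′ Γ⇛Γ′) (step-π⁺ i) =
    _ , step-π⁺ (backIndex Γ⇛Γ′ i) ,
    node Δ⇛Δ′ (lookup-toℕ⁺ Γ⇛Γ′ _ i (toℕ-backIndex Γ⇛Γ′ i) ∷ Γ⇛Γ′)
  ⇛-postpone-root (node Δ⇛Δ′ Γ⇛Γ′) (step-π⁻ i) =
    _ , step-π⁻ (backIndex Γ⇛Γ′ i) ,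
    node Δ⇛Δ′ (removeAt-toℕ⁺ Γ⇛Γ′ _ i (toℕ-backIndex Γ⇛Γ′ i))
  ⇛-postpone-root (node Δ⇛Δ′ Γ⇛Γ′) (step-4 i Γ[i]≡βV j V[j]≡βS)
    with lookup-⇛ᴱ⁻ Γ⇛Γ′ i Γ[i]≡βV
  ... | node _ Γ₁ , Γ[i′]≡βV′ , node _ Γ₁⇛Γ₁′
    with lookup-⇛ᴱ⁻ Γ₁⇛Γ₁′ j V[j]≡βS
  ... | _ , Γ₁[j′]≡βS′ , S′⇛S =
    _ , step-4 _ Γ[i′]≡βV′ _ Γ₁[j′]≡βS′ ,
    node Δ⇛Δ′ (∷=-toℕ⁺ Γ⇛Γ′ _ i (toℕ-backIndex Γ⇛Γ′ i) (edge S′⇛S))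
  ⇛-postpone-root (node Δ⇛Δ′ Γ⇛Γ′) (step-λ i Γ[i]≡αS β<α)
    with lookup-⇛ᴱ⁻ Γ⇛Γ′ i Γ[i]≡αS
  ... | _ , Γ[i′]≡αS′ , S′⇛S =
    _ , step-λ _ Γ[i′]≡αS′ β<α ,
    node Δ⇛Δ′ (∷=-toℕ⁺ Γ⇛Γ′ _ i (toℕ-backIndex Γ⇛Γ′ i) (edge S′⇛S))
  ⇛-postpone-root (node Δ⇛Δ′ Γ⇛Γ′) (step-J i j i≢j Γ[i]≡αV Γ[j]≡βS β<α)
    with lookup-⇛ᴱ⁻ Γ⇛Γ′ i Γ[i]≡αV | lookup-⇛ᴱ⁻ Γ⇛Γ′ j Γ[j]≡βS
  ... | node _ Γ₁ , Γ[i′]≡αV′ , node Δ₁⇛Δ₁′ Γ₁⇛Γ₁′ | _ , Γ[j′]≡βS′ , S′⇛S =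
    _ , step-J _ _ (i≢j ∘ backIndex-injective Γ⇛Γ′) Γ[i′]≡αV′ Γ[j′]≡βS′ β<α ,
    node Δ⇛Δ′ (removeAt-toℕ⁺ (∷=-toℕ⁺ Γ⇛Γ′ _ i (toℕ-backIndex Γ⇛Γ′ i)
                   (edge (node Δ₁⇛Δ₁′ (++⁺ Γ₁⇛Γ₁′ (edge S′⇛S ∷ []))))) _ _
                 (trans (toℕ-cast _ _) (trans (toℕ-backIndex Γ⇛Γ′ j) (sym (toℕ-cast _ j)))))

  ⇛-postpone : ∀ {μ T U S} → T ⇛⟨ ρ ⟩ U → Step (other μ) U S →
               (Step (other μ) then _⇛⟨ ρ ⟩_) T S
  ⇛-postpone T⇛U (here s) = map₂ (map₁ here) (⇛-postpone-root T⇛U s)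
  ⇛-postpone (node Δ⇛Δ′ Γ⇛Γ′) (under i Γ[i]≡αU s)
    with lookup-⇛ᴱ⁻ Γ⇛Γ′ i Γ[i]≡αU
  ... | _ , Γ[i′]≡αT , T⇛U
    with ⇛-postpone T⇛U s
  ... | _ , s′ , S′⇛S =
    _ , under _ Γ[i′]≡αT s′ , node Δ⇛Δ′ (∷=-toℕ⁺ Γ⇛Γ′ _ i (toℕ-backIndex Γ⇛Γ′ i) (edge S′⇛S))

mainTheorem17 : (ρ : AtomicRule) (μ : OtherRule) (T S : Tree) →
    (Step (atomic ρ) then Step (other μ)) T S →
    (Step (other μ) then Steps* (atomic ρ)) T S
mainTheorem17 ρ μ T S (U , T↪U , U↪S) =
  map₂ (map₂ ⇛⇒steps) (⇛-postpone (step⇒⇛ T↪U) U↪S)
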